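{- Every finite tangled closure algebra $(A,\mathbf{C}^t_A)$ is isomorphic (as a tangled closure algebra) to $(A_S,\mathbf{C}^t_R)$ for some finite quasi-ordered set $(S,R)$.
   Context: A Boolean algebra $A$ has operations $\land,\lor,-,0,1$; $a\Rightarrow b=-a\lor b$. A closure operator on $A$ is $\mathbf{C}:A\to A$ with $\mathbf{C}(a\lor b)=\mathbf{C}a\lor\mathbf{C}b$, $\mathbf{C}0=0$, $a\leq\mathbf{C}a=\mathbf{C}\mathbf{C}a$; interior $\mathbf{I}a=-\mathbf{C}-a$. $\mathcal{P}_{fin}A$ is the set of finite non-empty subsets of $A$. For $\mathbf{C}^t:\mathcal{P}_{fin}A\to A$, the induced $\mathbf{C}a=\mathbf{C}^t\{a\}$, $\mathbf{I}a=-\mathbf{C}^t\{ -a\}$; $(A,\mathbf{C}^t)$ is a tangled closure algebra if $\mathbf{C}$ is a closure operator and for all $\varGamma\in\mathcal{P}_{fin}A$, $a\in A$: (Fix) $\mathbf{C}^t\varGamma\leq\bigwedge_{\gamma\in\varGamma}\mathbf{C}(\gamma\land\mathbf{C}^t\varGamma)$; (Ind) $\mathbf{I}(a\Rightarrow\bigwedge_{\gamma\in\varGamma}\mathbf{C}(\gamma\land a))\land a\leq\mathbf{C}^t\varGamma$. An isomorphism of tangled closure algebras is a Boolean isomorphism $f$ with $f(\mathbf{C}^t_A\varGamma)=\mathbf{C}^t_B\{f\gamma:\gamma\in\varGamma\}$. For a quasi-ordered set $(S,R)$ ($R$ reflexive and transitive), $A_S$ is the powerset Boolean algebra of $S$,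 $\mathbf{C}_R(a)=R^{ -1}(a)=\{x:\exists y\,(xRy\text{ and }y\in a)\}$, and $\mathbf{C}^t_R\varGamma=\bigcup\{a\subseteq S: a\subseteq\bigcap_{\gamma\in\varGamma}R^{ -1}(\gamma\cap a)\}$. -}

module Defs where

open import Level using (Level; _⊔_)
open import Data.Nat using (ℕ)
open import Data.Fin using (Fin)
open import Data.Fin.Subset using (Subset; _∈_; _∩_; _∪_; ∁) renaming (⊥ to ∅; ⊤ to Full)
open import Data.List.NonEmpty using (List⁺; toList; [_]) renaming (map to map⁺)
open import Data.List using (foldr)
open import Data.List.Relation.Unary.All using (All)
open import Data.List.Relation.Unary.Any using (Any)
open import Data.Product using (Σ; ∃; _×_)
open import Relation.Binary.PropositionalEquality using (_≡_)
open import Relation.Binary.Bundles using (Setoid)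
open import Relation.Binary.PropositionalEquality.Properties using () renaming (setoid to ≡-setoid)
open import Function.Bundles using (Bijection)
open import Algebra.Lattice.Bundles using (BooleanAlgebra)

Finite : ∀ {c ℓ} → BooleanAlgebra c ℓ → Set (c ⊔ ℓ)
Finite B = Σ ℕ λ n → Bijection (BooleanAlgebra.setoid B) (≡-setoid (Fin n))

-- Tangled closure algebras.  Finite non-empty subsets of A are
-- represented by non-empty lists; C^t is required to be a function of
-- the underlying set (invariance under ≋ below).

module _ {c ℓ} (B : BooleanAlgebra c ℓ) where
  open BooleanAlgebra B

  _≤_ : Carrier → Carrier → Set ℓ
  a ≤ b = a ∧ b ≈ a

  _⇒_ : Carrier → Carrier → Carrier
  a ⇒ b = (¬ a) ∨ b

  ⋀ : List⁺ Carrier → Carrier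
  ⋀ Γ = foldr _∧_ ⊤ (toList Γ)

  _≋_ : List⁺ Carrier → List⁺ Carrier → Set (c ⊔ ℓ)
  Γ ≋ Δ = All (λ γ → Any (γ ≈_) (toList Δ)) (toList Γ)
        × All (λ δ → Any (δ ≈_) (toList Γ)) (toList Δ)

  record IsTangledClosure (Ct : List⁺ Carrier → Carrier) : Set (c ⊔ ℓ) where
    C : Carrier → Carrier
    C a = Ct [ a ]
    I : Carrier → Carrier
    I a = ¬ C (¬ a)
    field
      Ct-set   : ∀ Γ Δ → Γ ≋ Δ → Ct Γ ≈ Ct Δ
      C-∨      : ∀ a b → C (a ∨ b) ≈ C a ∨ C b
      C-⊥      : C ⊥ ≈ ⊥
      C-incl   : ∀ a → a ≤ C a
      C-idem   : ∀ a → C a ≈ C (C a)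
      Fix      : ∀ Γ → Ct Γ ≤ ⋀ (map⁺ (λ γ → C (γ ∧ Ct Γ)) Γ)
      Ind      : ∀ Γ a → (I (a ⇒ ⋀ (map⁺ (λ γ → C (γ ∧ a)) Γ)) ∧ a) ≤ Ct Γ

record TangledClosureAlgebra c ℓ : Set (Level.suc (c ⊔ ℓ)) where
  field
    boolean   : BooleanAlgebra c ℓ
    Ct        : List⁺ (BooleanAlgebra.Carrier boolean) → BooleanAlgebra.Carrier boolean
    isTangled : IsTangledClosure boolean Ct

FiniteTCA : ∀ {c ℓ} → TangledClosureAlgebra c ℓ → Set (c ⊔ ℓ)
FiniteTCA T = Finite (TangledClosureAlgebra.boolean T)

-- Finite quasi-ordered sets (S = Fin n) and the powerset algebra A_S,
-- represented by Subset n (with propositional equality).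

record QuasiOrder (n : ℕ) : Set₁ where
  field
    R     : Fin n → Fin n → Set
    refl  : ∀ x → R x x
    trans : ∀ {x y z} → R x y → R y z → R x z

module _ {n : ℕ} (Q : QuasiOrder n) where
  open QuasiOrder Q

  C-R : Subset n → Fin n → Set
  C-R b x = ∃ λ y → R x y × y ∈ b

  Ct-R : List⁺ (Subset n) → Fin n → Set
  Ct-R Γ x = ∃ λ (a : Subset n) → x ∈ a
             × (∀ y → y ∈ a → All (λ γ → C-R (γ ∩ a) y) (toList Γ))

record IsTCAIsoToFrames {c ℓ} (T : TangledClosureAlgebra c ℓ) {n : ℕ} (Q : QuasiOrder n)
                        (f : BooleanAlgebra.Carrier (TangledClosureAlgebra.boolean T) → Subset n)
                        : Set (c ⊔ ℓ) where
  open TangledClosureAlgebra T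
  open BooleanAlgebra boolean
  field
    cong      : ∀ {a b} → a ≈ b → f a ≡ f b
    injective : ∀ {a b} → f a ≡ f b → a ≈ b
    surjective : ∀ (s : Subset n) → ∃ λ a → f a ≡ s
    pres-∧ : ∀ a b → f (a ∧ b) ≡ f a ∩ f b
    pres-∨ : ∀ a b → f (a ∨ b) ≡ f a ∪ f b
    pres-¬ : ∀ a → f (¬ a) ≡ ∁ (f a)
    pres-⊥ : f ⊥ ≡ ∅
    pres-⊤ : f ⊤ ≡ Full
    pres-Ct-⇒ : ∀ Γ x → x ∈ f (Ct Γ) → Ct-R Q (map⁺ f Γ) x
    pres-Ct-⇐ : ∀ Γ x → Ct-R Q (map⁺ f Γ) x → x ∈ f (Ct Γ)

module Submission where

-- Let A be finite.  Then A is atomic: listing its atoms as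
-- atom : Fin n → A, the map rep a = {k | atom k ≤ a} is a Boolean isomorphism
-- A ≅ Subset n (module FiniteBoolean, built on the order and atom facts of
-- BooleanAtoms).  On the atoms put x R y iff atom x ≤ C (atom y); this is a
-- quasi-order because C is extensive, monotone and idempotent.  Since every a
-- is the join of the atoms below it, C distributes over that join and atoms
-- are join-prime, rep (C a) = R⁻¹ (rep a).  Finally (Fix) and (Ind) say that
-- C^t Γ is the greatest post-fixpoint of a ↦ ⋀_γ C (γ ∧ a) (module
-- TangledClosureFacts), while C^t_R (rep[Γ]) is by definition the union of
-- the post-fixpoints of the corresponding operator on Subset n; as rep is an
-- isomorphism commuting with C and ∧, it carries one onto the other (module
-- Representation).

open import Defs
open import Data.Nat using (ℕ)
open import Data.Product using (Σ; ∃)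
open import Data.Fin.Subset using (Subset)

open import Level using (_⊔_)
open import Data.Fin using (Fin; zero; suc)
import Data.Fin.Properties as FinProps
open import Data.Fin.Subset using (_∈_; _⊂_; _∩_; _∪_; ∁) renaming (⊥ to ∅; ⊤ to Full)
open import Data.Fin.Subset.Properties
  using (⊆-antisym; x∈p∩q⁺; x∈p∩q⁻; x∈p∪q⁺; x∈p∪q⁻; x∈∁p⇒x∉p; x∉p⇒x∈∁p; ∈⊤; ∉⊥; _∈?_)
open import Data.Fin.Subset.Induction using (⊂-wellFounded)
open import Data.Vec using (tabulate)
open import Data.Vec.Properties using (lookup∘tabulate; lookup⇒[]=; []=⇒lookup)
open import Data.Product using (_,_; proj₁; proj₂; _×_)
open import Data.Sum using (_⊎_; inj₁; inj₂; [_,_]′)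
import Data.Sum as Sum
open import Data.List using (List; []; _∷_; foldr; filter; allFin; length; lookup)
import Data.List as List
open import Data.List.NonEmpty using (List⁺; toList; [_]) renaming (map to map⁺)
open import Data.List.Relation.Unary.All using (All; []; _∷_)
import Data.List.Relation.Unary.All as All
import Data.List.Relation.Unary.All.Properties as AllProps
open import Data.List.Relation.Unary.Any using (Any; here; there; index)
import Data.List.Relation.Unary.Any as Any
import Data.List.Relation.Unary.Any.Properties as AnyProps
open import Data.List.Relation.Unary.Unique.Propositional using (Unique)
import Data.List.Relation.Unary.AllPairs as AllPairs
import Data.List.Relation.Unary.Unique.Propositional.Properties as UniqueProps
open import Data.List.Membership.Propositional using (find) renaming (_∈_ to _∈ₗ_)
open import Data.List.Membership.Propositional.Properties using (∈-allFin; ∈-filter⁺; ∈-filter⁻; ∈-lookup)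
open import Relation.Nullary using (Dec; yes; no; does; contradiction) renaming (¬_ to Not)
open import Relation.Nullary.Decidable using (dec-true; _×-dec_; ¬?; map′)
open import Relation.Unary using (Pred; Decidable)
open import Relation.Binary.PropositionalEquality as ≡ using (_≡_)
open import Induction.WellFounded using (WellFounded; Acc; acc)
import Induction.WellFounded as WF
import Relation.Binary.Construct.On as On
open import Function.Bundles using (Inverse)
open import Function.Properties.Bijection using (Bijection⇒Inverse)
open import Algebra.Lattice.Bundles using (BooleanAlgebra)

module _ {n p} {P : Pred (Fin n) p} (P? : Decidable P) where

  ⟦_⟧ : Subset n
  ⟦_⟧ = tabulate (λ i → does (P? i))

  ∈⟦⟧⁺ : ∀ {i} → P i → i ∈ ⟦_⟧
  ∈⟦⟧⁺ {i} pi = lookup⇒[]= i ⟦_⟧ (≡.trans (lookup∘tabulate _ i) (dec-true (P? i) pi))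

  ∈⟦⟧⁻ : ∀ {i} → i ∈ ⟦_⟧ → P i
  ∈⟦⟧⁻ {i} i∈ with P? i | ≡.trans (≡.sym (lookup∘tabulate (λ j → does (P? j)) i)) ([]=⇒lookup i∈)
  ... | yes pi | _  = pi
  ... | no _   | ()

lookup-injective : ∀ {a} {A : Set a} {xs : List A} → Unique xs →
                   ∀ i j → lookup xs i ≡ lookup xs j → i ≡ j
lookup-injective (_ AllPairs.∷ _) zero zero _ = ≡.refl
lookup-injective (x≢ AllPairs.∷ _) zero (suc j) eq = contradiction eq (All.lookup x≢ (∈-lookup j))
lookup-injective (x≢ AllPairs.∷ _) (suc i) zero eq = contradiction (≡.sym eq) (All.lookup x≢ (∈-lookup i))
lookup-injective (_ AllPairs.∷ u) (suc i) (suc j) eq = ≡.cong suc (lookup-injective u i j eq)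

-- Order-theoretic facts and atoms in an arbitrary Boolean algebra.  We use
-- the library's natural order a ⊑ b ⇔ a ≈ a ∧ b, the mirror image of the
-- order a ∧ b ≈ a used in Defs.
module BooleanAtoms {c ℓ} (B : BooleanAlgebra c ℓ) where
  open BooleanAlgebra B
  open import Algebra.Lattice.Properties.BooleanAlgebra B
    using (∧-zeroʳ; ∧-identityʳ; ∨-identityʳ)
  open import Algebra.Lattice.Properties.Lattice lattice using (∨-∧-orderTheoreticLattice)
  open import Relation.Binary.Lattice.Bundles using (module Lattice)
  open Lattice ∨-∧-orderTheoreticLattice public
    using (x≤x∨y; y≤x∨y; ∨-least; x∧y≤x; x∧y≤y; ∧-greatest)
    renaming (_≤_ to _⊑_; refl to ⊑-refl; trans to ⊑-trans; antisym to ⊑-antisym;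
              ≤-respˡ-≈ to ⊑-respˡ; ≤-respʳ-≈ to ⊑-respʳ; reflexive to ≈⇒⊑)
  open import Relation.Binary.Reasoning.Setoid setoid

  ≤⇒⊑ : ∀ {a b} → _≤_ B a b → a ⊑ b
  ≤⇒⊑ = sym

  ⊑-⊤ : ∀ {a} → a ⊑ ⊤
  ⊑-⊤ {a} = sym (∧-identityʳ a)

  ⊑⇒∨≈ : ∀ {a b} → a ⊑ b → a ∨ b ≈ b
  ⊑⇒∨≈ {a} {b} a⊑b = ⊑-antisym (∨-least a⊑b ⊑-refl) (y≤x∨y a b)

  ⊑⊥⇒≈⊥ : ∀ {a} → a ⊑ ⊥ → a ≈ ⊥
  ⊑⊥⇒≈⊥ {a} a⊑⊥ = trans a⊑⊥ (∧-zeroʳ a)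

  ⊑-both⇒≈⊥ : ∀ {p a} → p ⊑ a → p ⊑ ¬ a → p ≈ ⊥
  ⊑-both⇒≈⊥ {p} {a} p⊑a p⊑¬a = ⊑⊥⇒≈⊥ (⊑-respʳ (∧-complementʳ a) (∧-greatest p⊑a p⊑¬a))

  disjoint⇒⊑ : ∀ {a b} → a ∧ ¬ b ≈ ⊥ → a ⊑ b
  disjoint⇒⊑ {a} {b} a∧¬b≈⊥ = begin
    a                    ≈⟨ sym (∧-identityʳ a) ⟩
    a ∧ ⊤                ≈⟨ ∧-congˡ (sym (∨-complementʳ b)) ⟩
    a ∧ (b ∨ ¬ b)        ≈⟨ ∧-distribˡ-∨ a b (¬ b) ⟩
    (a ∧ b) ∨ (a ∧ ¬ b)  ≈⟨ ∨-congˡ a∧¬b≈⊥ ⟩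
    (a ∧ b) ∨ ⊥          ≈⟨ ∨-identityʳ (a ∧ b) ⟩
    a ∧ b                ∎

  ⊑-⋀⁺ : ∀ {x} (h : Carrier → Carrier) (l : List Carrier) →
         All (λ γ → x ⊑ h γ) l → x ⊑ foldr _∧_ ⊤ (List.map h l)
  ⊑-⋀⁺ h [] [] = ⊑-⊤
  ⊑-⋀⁺ h (γ ∷ l) (x⊑hγ ∷ x⊑hl) = ∧-greatest x⊑hγ (⊑-⋀⁺ h l x⊑hl)

  ⊑-⋀⁻ : ∀ {x} (h : Carrier → Carrier) (l : List Carrier) →
         x ⊑ foldr _∧_ ⊤ (List.map h l) → All (λ γ → x ⊑ h γ) l
  ⊑-⋀⁻ h [] _ = []
  ⊑-⋀⁻ h (γ ∷ l) x⊑ = ⊑-trans x⊑ (x∧y≤x _ _) ∷ ⊑-⋀⁻ h l (⊑-trans x⊑ (x∧y≤y _ _))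

  ⋁ : List Carrier → Carrier
  ⋁ = foldr _∨_ ⊥

  ⊑-⋁ : ∀ {x} {l : List Carrier} → Any (x ⊑_) l → x ⊑ ⋁ l
  ⊑-⋁ (here x⊑y) = ⊑-trans x⊑y (x≤x∨y _ _)
  ⊑-⋁ (there x⊑l) = ⊑-trans (⊑-⋁ x⊑l) (y≤x∨y _ _)

  Atom : Carrier → Set (c ⊔ ℓ)
  Atom p = p ≉ ⊥ × (∀ b → b ⊑ p → b ≈ ⊥ ⊎ b ≈ p)

  Atom-resp : ∀ {p q} → p ≈ q → Atom p → Atom q
  Atom-resp p≈q (p≉⊥ , minimal) =
    (λ q≈⊥ → p≉⊥ (trans p≈q q≈⊥)) ,
    λ b b⊑q → Sum.map₂ (λ b≈p → trans b≈p p≈q) (minimal b (⊑-respʳ (sym p≈q) b⊑q))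

  atom-∨ : ∀ {p a b} → Atom p → p ⊑ a ∨ b → p ⊑ a ⊎ p ⊑ b
  atom-∨ {p} {a} {b} (p≉⊥ , minimal) p⊑a∨b
    with minimal (p ∧ a) (x∧y≤x p a) | minimal (p ∧ b) (x∧y≤x p b)
  ... | inj₂ p∧a≈p | _ = inj₁ (sym p∧a≈p)
  ... | inj₁ _ | inj₂ p∧b≈p = inj₂ (sym p∧b≈p)
  ... | inj₁ p∧a≈⊥ | inj₁ p∧b≈⊥ = contradiction (begin
    p                  ≈⟨ p⊑a∨b ⟩
    p ∧ (a ∨ b)        ≈⟨ ∧-distribˡ-∨ p a b ⟩
    (p ∧ a) ∨ (p ∧ b)  ≈⟨ ∨-cong p∧a≈⊥ p∧b≈⊥ ⟩
    ⊥ ∨ ⊥              ≈⟨ ∨-identityʳ ⊥ ⟩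
    ⊥                  ∎) p≉⊥

  atom-⋁ : ∀ {p} {l : List Carrier} → Atom p → p ⊑ ⋁ l → Any (p ⊑_) l
  atom-⋁ {l = []} (p≉⊥ , _) p⊑⊥ = contradiction (⊑⊥⇒≈⊥ p⊑⊥) p≉⊥
  atom-⋁ {l = x ∷ l} atom p⊑ = [ here , (λ p⊑⋁l → there (atom-⋁ atom p⊑⋁l)) ]′ (atom-∨ atom p⊑)

  atom-⊑-or-⊑¬ : ∀ {p} a → Atom p → p ⊑ a ⊎ p ⊑ ¬ a
  atom-⊑-or-⊑¬ a atom = atom-∨ atom (⊑-respʳ (sym (∨-complementʳ a)) ⊑-⊤)

  atom-⊑-atom : ∀ {p q} → Atom p → Atom q → p ⊑ q → p ≈ q
  atom-⊑-atom (p≉⊥ , _) (_ , minimal) p⊑q = [ (λ p≈⊥ → contradiction p≈⊥ p≉⊥) , (λ p≈q → p≈q) ]′ (minimal _ p⊑q)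

-- Finiteness enters in two ways: equality is
-- decidable (so is ∃ over the carrier), and proper parts form a
-- well-founded relation (their down-sets shrink in Subset N).
module FiniteBoolean {c ℓ} (B : BooleanAlgebra c ℓ) (fin : Finite B) where
  open BooleanAlgebra B
  open BooleanAtoms B

  private
    N : ℕ
    N = proj₁ fin

    open Inverse (Bijection⇒Inverse (proj₂ fin))
      using (to; from; to-cong; strictlyInverseˡ; strictlyInverseʳ)

    to-injective : ∀ {a b} → to a ≡ to b → a ≈ b
    to-injective {a} {b} eq = begin
      a              ≈⟨ sym (strictlyInverseʳ a) ⟩
      from (to a)    ≡⟨ ≡.cong from eq ⟩
      from (to b)    ≈⟨ strictlyInverseʳ b ⟩
      b              ∎
      where open import Relation.Binary.Reasoning.Setoid setoid

  _≈?_ : ∀ a b → Dec (a ≈ b)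
  a ≈? b = map′ to-injective to-cong (to a FinProps.≟ to b)

  _⊑?_ : ∀ a b → Dec (a ⊑ b)
  a ⊑? b = a ≈? (a ∧ b)

  ∃? : ∀ {p} {P : Carrier → Set p} → (∀ {a b} → a ≈ b → P a → P b) →
       Decidable P → Dec (∃ P)
  ∃? resp P? = map′ (λ (i , Pi) → from i , Pi)
                    (λ (a , Pa) → to a , resp (sym (strictlyInverseʳ a)) Pa)
                    (FinProps.any? (λ i → P? (from i)))

  -- Strict order.  It is well founded since the down-set ↓ a of codes of
  -- elements below a strictly shrinks along it.
  _⊏_ : Carrier → Carrier → Set ℓ
  b ⊏ a = b ⊑ a × b ≉ a

  private
    below? : ∀ a i → Dec (from i ⊑ a)
    below? a i = from i ⊑? a

    ↓ : Carrier → Subset N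
    ↓ a = ⟦ below? a ⟧

  ⊏⇒↓⊂ : ∀ {a b} → b ⊏ a → ↓ b ⊂ ↓ a
  ⊏⇒↓⊂ {a} {b} (b⊑a , b≉a) =
    (λ i∈↓b → ∈⟦⟧⁺ (below? a) (⊑-trans (∈⟦⟧⁻ (below? b) i∈↓b) b⊑a)) ,
    to a , ∈⟦⟧⁺ (below? a) (≈⇒⊑ (strictlyInverseʳ a)) ,
    λ a∈↓b → b≉a (⊑-antisym b⊑a (⊑-respˡ (strictlyInverseʳ a) (∈⟦⟧⁻ (below? b) a∈↓b)))

  ⊏-wellFounded : WellFounded _⊏_
  ⊏-wellFounded = WF.Subrelation.wellFounded ⊏⇒↓⊂ (On.wellFounded ↓ ⊂-wellFounded)

  NonzeroPart : Carrier → Carrier → Set ℓ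
  NonzeroPart a b = b ⊏ a × b ≉ ⊥

  nonzeroPart? : ∀ a → Dec (∃ (NonzeroPart a))
  nonzeroPart? a = ∃? resp (λ b → ((b ⊑? a) ×-dec ¬? (b ≈? a)) ×-dec ¬? (b ≈? ⊥))
    where
      resp : ∀ {b b′} → b ≈ b′ → NonzeroPart a b → NonzeroPart a b′
      resp b≈b′ ((b⊑a , b≉a) , b≉⊥) =
        (⊑-respˡ b≈b′ b⊑a , λ b′≈a → b≉a (trans b≈b′ b′≈a)) , λ b′≈⊥ → b≉⊥ (trans b≈b′ b′≈⊥)

  atom⇒noPart : ∀ {a} → Atom a → Not (∃ (NonzeroPart a))
  atom⇒noPart (_ , minimal) (b , (b⊑a , b≉a) , b≉⊥) = [ b≉⊥ , b≉a ]′ (minimal b b⊑a)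

  noPart⇒atom : ∀ {a} → a ≉ ⊥ → Not (∃ (NonzeroPart a)) → Atom a
  noPart⇒atom {a} a≉⊥ noPart = a≉⊥ , minimal
    where
      minimal : ∀ b → b ⊑ a → b ≈ ⊥ ⊎ b ≈ a
      minimal b b⊑a with b ≈? ⊥ | b ≈? a
      ... | yes b≈⊥ | _       = inj₁ b≈⊥
      ... | no _    | yes b≈a = inj₂ b≈a
      ... | no b≉⊥  | no b≉a  = contradiction (b , (b⊑a , b≉a) , b≉⊥) noPart

  Atom? : Decidable Atom
  Atom? a = map′ (λ (a≉⊥ , noPart) → noPart⇒atom a≉⊥ noPart)
                 (λ atom → proj₁ atom , atom⇒noPart atom)
                 (¬? (a ≈? ⊥) ×-dec ¬? (nonzeroPart? a))

  atom-below : ∀ {a} → a ≉ ⊥ → ∃ λ p → Atom p × p ⊑ a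
  atom-below {a} = descend (⊏-wellFounded a)
    where
      descend : ∀ {a} → Acc _⊏_ a → a ≉ ⊥ → ∃ λ p → Atom p × p ⊑ a
      descend {a} (acc smaller) a≉⊥ with nonzeroPart? a
      ... | no noPart = a , noPart⇒atom a≉⊥ noPart , ⊑-refl
      ... | yes (b , b⊏a , b≉⊥) with descend (smaller b⊏a) b≉⊥
      ...   | p , atom , p⊑b = p , atom , ⊑-trans p⊑b (proj₁ b⊏a)

  -- The atoms, listed without repetition by their codes in Fin N.  The
  -- list is opaque: only the three properties below are ever used.
  opaque
    atomCodes : List (Fin N)
    atomCodes = filter (λ i → Atom? (from i)) (allFin N)

    atomCodes-unique : Unique atomCodes
    atomCodes-unique = UniqueProps.filter⁺ (λ i → Atom? (from i)) (UniqueProps.allFin⁺ N)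

    atomCodes-sound : All (λ i → Atom (from i)) atomCodes
    atomCodes-sound = AllProps.all-filter (λ i → Atom? (from i)) (allFin N)

    atomCodes-complete : ∀ {i} → Atom (from i) → i ∈ₗ atomCodes
    atomCodes-complete {i} = ∈-filter⁺ (λ i → Atom? (from i)) (∈-allFin i)

  n : ℕ
  n = length atomCodes

  atom : Fin n → Carrier
  atom k = from (lookup atomCodes k)

  atom-isAtom : ∀ k → Atom (atom k)
  atom-isAtom k = All.lookup atomCodes-sound (∈-lookup k)

  atom-injective : ∀ {k j} → atom k ≈ atom j → k ≡ j
  atom-injective {k} {j} atomk≈atomj =
    lookup-injective atomCodes-unique k j (begin
      lookup atomCodes k          ≡⟨ strictlyInverseˡ _ ⟨
      to (atom k)                 ≡⟨ to-cong atomk≈atomj ⟩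
      to (atom j)                 ≡⟨ strictlyInverseˡ _ ⟩
      lookup atomCodes j          ∎)
    where open ≡.≡-Reasoning

  atom-index : ∀ {p} → Atom p → ∃ λ k → atom k ≈ p
  atom-index {p} atom-p = index code∈ , (begin
      atom (index code∈)   ≡⟨ ≡.cong from (AnyProps.lookup-index code∈) ⟨
      from (to p)          ≈⟨ strictlyInverseʳ p ⟩
      p                    ∎)
    where
      open import Relation.Binary.Reasoning.Setoid setoid
      code∈ : to p ∈ₗ atomCodes
      code∈ = atomCodes-complete (Atom-resp (sym (strictlyInverseʳ p)) atom-p)

  atomic : ∀ {a} → a ≉ ⊥ → ∃ λ k → atom k ⊑ a
  atomic a≉⊥ with atom-below a≉⊥
  ... | p , atom-p , p⊑a with atom-index atom-p
  ...   | k , atomk≈p = k , ⊑-respˡ (sym atomk≈p) p⊑a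

  ⊑-by-atoms : ∀ {a b} → (∀ k → atom k ⊑ a → atom k ⊑ b) → a ⊑ b
  ⊑-by-atoms {a} {b} atoms⊑ = byCases ((a ∧ ¬ b) ≈? ⊥)
    where
      noAtomBelow : ∀ k → atom k ⊑ a ∧ ¬ b → atom k ≈ ⊥
      noAtomBelow k atomk⊑ =
        ⊑-both⇒≈⊥ (atoms⊑ k (⊑-trans atomk⊑ (x∧y≤x a (¬ b)))) (⊑-trans atomk⊑ (x∧y≤y a (¬ b)))

      byCases : Dec (a ∧ ¬ b ≈ ⊥) → a ⊑ b
      byCases (yes disjoint) = disjoint⇒⊑ disjoint
      byCases (no a∧¬b≉⊥) =
        let (k , atomk⊑) = atomic a∧¬b≉⊥ in
        contradiction (noAtomBelow k atomk⊑) (proj₁ (atom-isAtom k))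

  rep : Carrier → Subset n
  rep a = ⟦ (λ k → atom k ⊑? a) ⟧

  ∈rep⁺ : ∀ {a k} → atom k ⊑ a → k ∈ rep a
  ∈rep⁺ {a} = ∈⟦⟧⁺ (λ k → atom k ⊑? a)

  ∈rep⁻ : ∀ {a k} → k ∈ rep a → atom k ⊑ a
  ∈rep⁻ {a} = ∈⟦⟧⁻ (λ k → atom k ⊑? a)

  -- rep respects ≈, reflects it (the order is determined by the atoms) and
  -- preserves the Boolean operations (atoms are join-prime).
  rep-cong : ∀ {a b} → a ≈ b → rep a ≡ rep b
  rep-cong a≈b = ⊆-antisym (λ k∈ → ∈rep⁺ (⊑-respʳ a≈b (∈rep⁻ k∈)))
                           (λ k∈ → ∈rep⁺ (⊑-respʳ (sym a≈b) (∈rep⁻ k∈)))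

  rep-injective : ∀ {a b} → rep a ≡ rep b → a ≈ b
  rep-injective eq = ⊑-antisym (⊑-by-atoms (λ k atomk⊑a → ∈rep⁻ (≡.subst (k ∈_) eq (∈rep⁺ atomk⊑a))))
                               (⊑-by-atoms (λ k atomk⊑b → ∈rep⁻ (≡.subst (k ∈_) (≡.sym eq) (∈rep⁺ atomk⊑b))))

  rep-∧ : ∀ a b → rep (a ∧ b) ≡ rep a ∩ rep b
  rep-∧ a b = ⊆-antisym
    (λ k∈ → x∈p∩q⁺ (∈rep⁺ (⊑-trans (∈rep⁻ k∈) (x∧y≤x a b)) , ∈rep⁺ (⊑-trans (∈rep⁻ k∈) (x∧y≤y a b))))
    (λ k∈ → let (k∈a , k∈b) = x∈p∩q⁻ _ _ k∈ in ∈rep⁺ (∧-greatest (∈rep⁻ k∈a) (∈rep⁻ k∈b)))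

  rep-∨ : ∀ a b → rep (a ∨ b) ≡ rep a ∪ rep b
  rep-∨ a b = ⊆-antisym
    (λ {k} k∈ → x∈p∪q⁺ (Sum.map ∈rep⁺ ∈rep⁺ (atom-∨ (atom-isAtom k) (∈rep⁻ k∈))))
    (λ k∈ → ∈rep⁺ ([ (λ k∈a → ⊑-trans (∈rep⁻ k∈a) (x≤x∨y a b)) ,
                     (λ k∈b → ⊑-trans (∈rep⁻ k∈b) (y≤x∨y a b)) ]′ (x∈p∪q⁻ _ _ k∈)))

  rep-¬ : ∀ a → rep (¬ a) ≡ ∁ (rep a)
  rep-¬ a = ⊆-antisym
    (λ {k} k∈ → x∉p⇒x∈∁p (λ k∈a → proj₁ (atom-isAtom k) (⊑-both⇒≈⊥ (∈rep⁻ k∈a) (∈rep⁻ k∈))))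
    (λ {k} k∈ → ∈rep⁺ ([ (λ atomk⊑a → contradiction (∈rep⁺ atomk⊑a) (x∈∁p⇒x∉p k∈)) , (λ ⊑¬a → ⊑¬a) ]′
                          (atom-⊑-or-⊑¬ a (atom-isAtom k))))

  rep-⊥ : rep ⊥ ≡ ∅
  rep-⊥ = ⊆-antisym (λ {k} k∈ → contradiction (⊑⊥⇒≈⊥ (∈rep⁻ k∈)) (proj₁ (atom-isAtom k))) (λ k∈ → contradiction k∈ ∉⊥)

  rep-⊤ : rep ⊤ ≡ Full
  rep-⊤ = ⊆-antisym (λ _ → ∈⊤) (λ _ → ∈rep⁺ ⊑-⊤)

  listed : Subset n → List (Fin n)
  listed s = filter (_∈? s) (allFin n)

  atomsIn : Subset n → List Carrier
  atomsIn s = List.map atom (listed s)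

  rep-⋁-atomsIn : ∀ s → rep (⋁ (atomsIn s)) ≡ s
  rep-⋁-atomsIn s = ⊆-antisym (λ {k} k∈ → only-listed k (∈rep⁻ k∈)) (λ {k} k∈s → ∈rep⁺ (all-listed k k∈s))
    where
      all-listed : ∀ k → k ∈ s → atom k ⊑ ⋁ (atomsIn s)
      all-listed k k∈s = ⊑-⋁ (AnyProps.map⁺ (Any.map (λ { ≡.refl → ⊑-refl }) k∈listed))
        where
          k∈listed : k ∈ₗ listed s
          k∈listed = ∈-filter⁺ (_∈? s) (∈-allFin k) k∈s

      only-listed : ∀ k → atom k ⊑ ⋁ (atomsIn s) → k ∈ s
      only-listed k atomk⊑ with find (AnyProps.map⁻ {xs = listed s} (atom-⋁ (atom-isAtom k) atomk⊑))
      ... | j , j∈ , atomk⊑atomj with atom-injective (atom-⊑-atom (atom-isAtom k) (atom-isAtom j) atomk⊑atomj)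
      ...   | ≡.refl = proj₂ (∈-filter⁻ (_∈? s) {xs = allFin n} j∈)

  rep-surjective : ∀ s → ∃ λ a → rep a ≡ s
  rep-surjective s = ⋁ (atomsIn s) , rep-⋁-atomsIn s

  ⋁-atoms-below : ∀ a → ⋁ (atomsIn (rep a)) ≈ a
  ⋁-atoms-below a = rep-injective (rep-⋁-atomsIn (rep a))

-- Consequences of the axioms of an arbitrary tangled closure algebra: C is
-- monotone and distributes over finite joins, and C^t Γ is the greatest
-- post-fixpoint of a ↦ ⋀_{γ ∈ Γ} C (γ ∧ a) — (Fix) says it is a
-- post-fixpoint, (Ind) that it lies above every post-fixpoint.
module TangledClosureFacts {c ℓ} (B : BooleanAlgebra c ℓ) {Ct} (tangled : IsTangledClosure B Ct) where
  open BooleanAlgebra B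
  open BooleanAtoms B
  open IsTangledClosure tangled
  open import Algebra.Lattice.Properties.BooleanAlgebra B
    using (¬⊤≈⊥; ¬⊥≈⊤; ∨-zeroˡ; ∧-identityˡ)
  open import Relation.Binary.Reasoning.Setoid setoid

  C-cong : ∀ {a b} → a ≈ b → C a ≈ C b
  C-cong {a} {b} a≈b = Ct-set [ a ] [ b ] (here a≈b ∷ [] , here (sym a≈b) ∷ [])

  C-extensive : ∀ a → a ⊑ C a
  C-extensive a = ≤⇒⊑ (C-incl a)

  C-mono : ∀ {a b} → a ⊑ b → C a ⊑ C b
  C-mono {a} {b} a⊑b = ⊑-respʳ (trans (sym (C-∨ a b)) (C-cong (⊑⇒∨≈ a⊑b))) (x≤x∨y (C a) (C b))

  C-⋁ : ∀ l → C (⋁ l) ≈ ⋁ (List.map C l)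
  C-⋁ []      = C-⊥
  C-⋁ (a ∷ l) = trans (C-∨ a (⋁ l)) (∨-congˡ (C-⋁ l))

  Step : List⁺ Carrier → Carrier → Carrier
  Step Γ a = ⋀ B (map⁺ (λ γ → C (γ ∧ a)) Γ)

  ⊑-Step⁺ : ∀ {x} Γ a → All (λ γ → x ⊑ C (γ ∧ a)) (toList Γ) → x ⊑ Step Γ a
  ⊑-Step⁺ Γ a = ⊑-⋀⁺ (λ γ → C (γ ∧ a)) (toList Γ)

  ⊑-Step⁻ : ∀ {x} Γ a → x ⊑ Step Γ a → All (λ γ → x ⊑ C (γ ∧ a)) (toList Γ)
  ⊑-Step⁻ Γ a = ⊑-⋀⁻ (λ γ → C (γ ∧ a)) (toList Γ)

  Ct-postfixpoint : ∀ Γ → Ct Γ ⊑ Step Γ (Ct Γ)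
  Ct-postfixpoint Γ = ≤⇒⊑ (Fix Γ)

  -- If a ⊑ Step Γ a then a ⇒ Step Γ a is ⊤, whose interior is ⊤, so (Ind)
  -- yields a ⊑ C^t Γ.
  Ct-greatest : ∀ Γ a → a ⊑ Step Γ a → a ⊑ Ct Γ
  Ct-greatest Γ a a⊑step = ⊑-respˡ interior∧a≈a (≤⇒⊑ (Ind Γ a))
    where
      implication≈⊤ : ¬ a ∨ Step Γ a ≈ ⊤
      implication≈⊤ = begin
        ¬ a ∨ Step Γ a          ≈⟨ ∨-congˡ (⊑⇒∨≈ a⊑step) ⟨
        ¬ a ∨ (a ∨ Step Γ a)    ≈⟨ ∨-assoc (¬ a) a (Step Γ a) ⟨
        (¬ a ∨ a) ∨ Step Γ a    ≈⟨ ∨-congʳ (∨-complementˡ a) ⟩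
        ⊤ ∨ Step Γ a            ≈⟨ ∨-zeroˡ (Step Γ a) ⟩
        ⊤                       ∎

      interior∧a≈a : I (¬ a ∨ Step Γ a) ∧ a ≈ a
      interior∧a≈a = begin
        ¬ C (¬ (¬ a ∨ Step Γ a)) ∧ a  ≈⟨ ∧-congʳ (¬-cong (C-cong (¬-cong implication≈⊤))) ⟩
        ¬ C (¬ ⊤) ∧ a                 ≈⟨ ∧-congʳ (¬-cong (C-cong ¬⊤≈⊥)) ⟩
        ¬ C ⊥ ∧ a                     ≈⟨ ∧-congʳ (¬-cong C-⊥) ⟩
        ¬ ⊥ ∧ a                       ≈⟨ ∧-congʳ ¬⊥≈⊤ ⟩
        ⊤ ∧ a                         ≈⟨ ∧-identityˡ a ⟩
        a                             ∎

module Representation {c ℓ} (T : TangledClosureAlgebra c ℓ) (fin : FiniteTCA T) where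
  open TangledClosureAlgebra T
  open BooleanAlgebra boolean
  open BooleanAtoms boolean
  open FiniteBoolean boolean fin public using (n; rep)
  open FiniteBoolean boolean fin hiding (n; rep)
  open TangledClosureFacts boolean isTangled
  open IsTangledClosure isTangled using (C; C-idem)

  frame : QuasiOrder n
  frame = record
    { R     = λ x y → x ∈ rep (C (atom y))
    ; refl  = λ x → ∈rep⁺ (C-extensive (atom x))
    ; trans = λ {x} {y} {z} xRy yRz →
        ∈rep⁺ (⊑-trans (∈rep⁻ xRy) (⊑-respʳ (sym (C-idem (atom z))) (C-mono (∈rep⁻ yRz))))
    }

  -- rep turns the closure C into R⁻¹.  For ⁺, write a as the join of the
  -- atoms below it: C a is then the join of their closures, and the atom x,
  -- being join-prime, lies below one of them.
  rep-C⁺ : ∀ {a x} → x ∈ rep (C a) → C-R frame (rep a) x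
  rep-C⁺ {a} {x} x∈ with find (AnyProps.map⁻ {xs = listed (rep a)} (AnyProps.map⁻ {xs = atomsIn (rep a)}
                              (atom-⋁ (atom-isAtom x) (⊑-respʳ C-a≈⋁ (∈rep⁻ x∈)))))
    where
      C-a≈⋁ : C a ≈ ⋁ (List.map C (atomsIn (rep a)))
      C-a≈⋁ = trans (C-cong (sym (⋁-atoms-below a))) (C-⋁ (atomsIn (rep a)))
  ... | y , y∈ , atomx⊑ = y , ∈rep⁺ atomx⊑ , proj₂ (∈-filter⁻ (_∈? rep a) {xs = allFin n} y∈)

  rep-C⁻ : ∀ {a x} → C-R frame (rep a) x → x ∈ rep (C a)
  rep-C⁻ (y , xRy , y∈) = ∈rep⁺ (⊑-trans (∈rep⁻ xRy) (C-mono (∈rep⁻ y∈)))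

  ⊑C∧⇒C-R : ∀ {γ b y} → atom y ⊑ C (γ ∧ b) → C-R frame (rep γ ∩ rep b) y
  ⊑C∧⇒C-R {γ} {b} {y} y⊑ = ≡.subst (λ s → C-R frame s y) (rep-∧ γ b) (rep-C⁺ (∈rep⁺ y⊑))

  C-R⇒⊑C∧ : ∀ {γ b y} → C-R frame (rep γ ∩ rep b) y → atom y ⊑ C (γ ∧ b)
  C-R⇒⊑C∧ {γ} {b} {y} yR = ∈rep⁻ (rep-C⁻ (≡.subst (λ s → C-R frame s y) (≡.sym (rep-∧ γ b)) yR))

  -- rep (C^t Γ) is itself a witness for C^t_R: by (Fix) it is a post-fixpoint.
  rep-Ct⁺ : ∀ Γ x → x ∈ rep (Ct Γ) → Ct-R frame (map⁺ rep Γ) x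
  rep-Ct⁺ Γ x x∈ = rep (Ct Γ) , x∈ , λ y y∈ →
    AllProps.map⁺ (All.map ⊑C∧⇒C-R (⊑-Step⁻ Γ (Ct Γ) (⊑-trans (∈rep⁻ y∈) (Ct-postfixpoint Γ))))

  -- Conversely any witness rep b is a post-fixpoint, so b ⊑ C^t Γ by (Ind).
  rep-Ct⁻ : ∀ Γ x → Ct-R frame (map⁺ rep Γ) x → x ∈ rep (Ct Γ)
  rep-Ct⁻ Γ x (s , x∈s , s-post) with rep-surjective s
  ... | b , ≡.refl = ∈rep⁺ (⊑-trans (∈rep⁻ x∈s) (Ct-greatest Γ b b-post))
    where
      b-post : b ⊑ Step Γ b
      b-post = ⊑-by-atoms λ k atomk⊑b →
        ⊑-Step⁺ Γ b (All.map C-R⇒⊑C∧ (AllProps.map⁻ (s-post k (∈rep⁺ atomk⊑b))))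

  isIso : IsTCAIsoToFrames T frame rep
  isIso = record
    { cong       = rep-cong
    ; injective  = rep-injective
    ; surjective = rep-surjective
    ; pres-∧     = rep-∧
    ; pres-∨     = rep-∨
    ; pres-¬     = rep-¬
    ; pres-⊥     = rep-⊥
    ; pres-⊤     = rep-⊤
    ; pres-Ct-⇒  = rep-Ct⁺
    ; pres-Ct-⇐  = rep-Ct⁻
    }

theorem3p1 : ∀ {c ℓ} (T : TangledClosureAlgebra c ℓ) → FiniteTCA T →
    Σ ℕ λ n → Σ (QuasiOrder n) λ Q → ∃ λ f → IsTCAIsoToFrames T Q f
theorem3p1 T fin = n , frame , rep , isIso
  where open Representation T fin
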